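{- For every integer $n>1$ there is an orientation of the path on $n$ vertices (a dipath $P_n$) that admits a strong$^*$ SV$(n,1)$AL, i.e. a total labeling with $\lambda(A)=\{1,\ldots,n-1\}$ whose subtractive vertex-weights are exactly $n,n+1,\ldots,2n-1$ (each occurring once).
   Context: All digraphs are finite and simple. A dipath $P_n$ is the path graph on $n$ vertices with each edge given a direction. For a digraph $G=(V,A)$, a total labeling is a bijection $\lambda:V\cup A\to\{1,2,\ldots,|V|+|A|\}$. The subtractive vertex-weight of a vertex $x$ is $wt^-(x)=\lambda(x)+\sum_{y\in V,\,yx\in A}\lambda(yx)-\sum_{y\in V,\,xy\in A}\lambda(xy)$. An SVAL is a total labeling whose subtractive vertex-weights are pairwise distinct; an SV$(a,d)$AL is an SVAL whose set of subtractive vertex-weights is $\{a,a+d,\ldots,a+(|V|-1)d\}$. A total labeling is strong$^*$ if $\lambda(A)=\{1,\ldots,|A|\}$. -}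

module Defs where

open import Data.Nat using (ℕ; zero; suc; _≤_; _<_; pred)
open import Data.Integer as ℤ using (ℤ; +_; _+_; _-_)
open import Data.Fin using (Fin; toℕ; inject₁) renaming (suc to fsuc)
open import Data.Bool using (Bool; if_then_else_)
open import Data.Sum using (_⊎_; inj₁; inj₂)
open import Data.Product using (∃; ∃-syntax; _×_; _,_)
open import Relation.Binary.PropositionalEquality using (_≡_)
open import Relation.Nullary using (Dec; does)
open import Function.Bundles using (_⤖_; Bijection)

record Digraph : Set where
  field
    nV   : ℕ
    nA   : ℕ
    tail : Fin nA → Fin nV
    head : Fin nA → Fin nV
open Digraph public

sumFin : (n : ℕ) → (Fin n → ℤ) → ℤ
sumFin zero    f = + 0
sumFin (suc n) f = f Data.Fin.zero + sumFin n (λ i → f (fsuc i))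

sumWhere : (n : ℕ) → (P : Fin n → Bool) → (Fin n → ℤ) → ℤ
sumWhere n P f = sumFin n (λ i → if P i then f i else + 0)

Elem : Digraph → Set
Elem G = Fin (nV G) ⊎ Fin (nA G)

-- A total labeling: a bijection V ∪ A → {1,…,|V|+|A|}, encoded as a
-- bijection onto Fin (|V|+|A|) with label value  toℕ + 1.
TotalLabeling : Digraph → Set
TotalLabeling G = Elem G ⤖ Fin (nV G Data.Nat.+ nA G)

label : (G : Digraph) → TotalLabeling G → Elem G → ℕ
label G λ' e = suc (toℕ (Bijection.to λ' e))

wt⁻ : (G : Digraph) → TotalLabeling G → Fin (nV G) → ℤ
wt⁻ G λ' x =
  (+ label G λ' (inj₁ x)
    + sumWhere (nA G) (λ a → does (head G a Data.Fin.≟ x)) (λ a → + label G λ' (inj₂ a)))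
    - sumWhere (nA G) (λ a → does (tail G a Data.Fin.≟ x)) (λ a → + label G λ' (inj₂ a))

IsSVAL : (G : Digraph) → TotalLabeling G → Set
IsSVAL G λ' = ∀ x y → wt⁻ G λ' x ≡ wt⁻ G λ' y → x ≡ y

IsSVadAL : (G : Digraph) → ℤ → ℤ → TotalLabeling G → Set
IsSVadAL G a d λ' =
  IsSVAL G λ'
  × (∀ x → ∃[ i ] (i < nV G × wt⁻ G λ' x ≡ a + (+ i) ℤ.* d))
  × (∀ i → i < nV G → ∃[ x ] (wt⁻ G λ' x ≡ a + (+ i) ℤ.* d))

IsStrong* : (G : Digraph) → TotalLabeling G → Set
IsStrong* G λ' =
  (∀ e → label G λ' (inj₂ e) ≤ nA G)
  × (∀ k → 1 ≤ k → k ≤ nA G → ∃[ e ] (label G λ' (inj₂ e) ≡ k))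

-- Orientation of the path on n vertices 0 — 1 — … — (n-1):
-- edge i joins i and i+1 (i < n-1); true means i → i+1, false means i+1 → i.
Orientation : ℕ → Set
Orientation n = Fin (pred n) → Bool

dipath : (n : ℕ) → Orientation n → Digraph
dipath zero    o = record { nV = 0 ; nA = 0 ; tail = λ () ; head = λ () }
dipath (suc m) o = record
  { nV = suc m
  ; nA = m
  ; tail = λ i → if o i then inject₁ i else fsuc i
  ; head = λ i → if o i then fsuc i else inject₁ i
  }

-- Orient every arc of the path 0 — 1 — ⋯ — m towards 0, give the arcs the labels 1, …, m
-- in order and the vertices the labels m+1, …, 2m+1 in order. The arc into vertex x carries
-- x+1 and the arc out of x carries x, so every vertex x < m has weight (m+1+x) + (x+1) − x,
-- while the endpoint m, with no arc into it, has weight (2m+1) − m. Listing the endpoint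
-- first and then the vertices 0, …, m−1, the weights are exactly n, n+1, …, 2n−1 for n = m+1.
module Submission where

open import Defs
open import Data.Nat using (ℕ; _<_)
open import Data.Integer using (+_)
open import Data.Product using (∃-syntax; _×_)

open import Algebra.Properties.AbelianGroup as ℤGroup using ()
open import Data.Bool using (false; if_then_else_)
open import Data.Fin as Fin using (Fin; toℕ; inject₁; fromℕ; fromℕ<; cast)
  renaming (zero to fzero; suc to fsuc)
import Data.Fin.Properties as Finₚ
open import Data.Integer as ℤ using (ℤ; NonZero)
import Data.Integer.Properties as ℤₚ
open import Data.Nat as ℕ using (zero; suc)
import Data.Nat.Properties as ℕₚ
open import Data.Nat.Tactic.RingSolver using (solve-∀)
open import Data.Product using (_,_)
open import Data.Sum using (inj₁; inj₂)
open import Data.Sum.Algebra using (⊎-comm)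
open import Function.Base using (_∘_)
open import Function.Bundles using (_↔_; mk↔ₛ′)
open import Function.Definitions using (Injective)
open import Function.Properties.Inverse using (↔-sym; ↔-trans; ↔⇒⤖)
open import Relation.Binary.PropositionalEquality
open import Relation.Nullary using (does; yes; no)
open import Relation.Nullary.Decidable using (dec-true; dec-false)

open ℤGroup ℤₚ.+-0-abelianGroup using (∙-cancelˡ; //-rightDividesʳ)

sumFin-cong : ∀ n {f g : Fin n → ℤ} → (∀ i → f i ≡ g i) → sumFin n f ≡ sumFin n g
sumFin-cong zero    f≗g = refl
sumFin-cong (suc n) f≗g = cong₂ ℤ._+_ (f≗g fzero) (sumFin-cong n (f≗g ∘ fsuc))

sumFin-zero : ∀ n {f : Fin n → ℤ} → (∀ i → f i ≡ + 0) → sumFin n f ≡ + 0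
sumFin-zero zero    f≗0 = refl
sumFin-zero (suc n) f≗0 = cong₂ ℤ._+_ (f≗0 fzero) (sumFin-zero n (f≗0 ∘ fsuc))

sumWhere-≟ : ∀ n (y : Fin n) (g : Fin n → ℤ) → sumWhere n (λ i → does (i Fin.≟ y)) g ≡ g y
sumWhere-≟ (suc n) fzero    g = trans (cong (λ s → g fzero ℤ.+ s) (sumFin-zero n (λ _ → refl)))
                                      (ℤₚ.+-identityʳ (g fzero))
sumWhere-≟ (suc n) (fsuc y) g = trans (ℤₚ.+-identityˡ _) (sumWhere-≟ n y (g ∘ fsuc))

sumWhere-≟-injective : ∀ n {k} {h : Fin n → Fin k} → Injective _≡_ _≡_ h →
  ∀ y (g : Fin n → ℤ) → sumWhere n (λ i → does (h i Fin.≟ h y)) g ≡ g y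
sumWhere-≟-injective n {h = h} h-injective y g =
  trans (sumFin-cong n (λ i → cong (λ b → if b then g i else + 0) (does-≟-image i)))
        (sumWhere-≟ n y g)
  where
  does-≟-image : ∀ i → does (h i Fin.≟ h y) ≡ does (i Fin.≟ y)
  does-≟-image i with i Fin.≟ y
  ... | yes refl = dec-true (h i Fin.≟ h i) refl
  ... | no  i≢y  = dec-false (h i Fin.≟ h y) (i≢y ∘ h-injective)

sumWhere-≟-∉ : ∀ n {k} (h : Fin n → Fin k) x → (∀ i → h i ≢ x) →
  (g : Fin n → ℤ) → sumWhere n (λ i → does (h i Fin.≟ x)) g ≡ + 0
sumWhere-≟-∉ n h x x∉h g =
  sumFin-zero n (λ i → cong (λ b → if b then g i else + 0) (dec-false (h i Fin.≟ x) (x∉h i)))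

cast↔ : ∀ {m n} → m ≡ n → Fin m ↔ Fin n
cast↔ eq = mk↔ₛ′ (cast eq) (cast (sym eq)) (Finₚ.cast-involutive eq (sym eq))
                                         (Finₚ.cast-involutive (sym eq) eq)

arcsFirst : (G : Digraph) → TotalLabeling G
arcsFirst G = ↔⇒⤖ (↔-trans (⊎-comm _ _) (↔-trans (↔-sym Finₚ.+↔⊎)
                           (cast↔ (ℕₚ.+-comm (nA G) (nV G)))))

label-arcsFirst-arc : ∀ G e → label G (arcsFirst G) (inj₂ e) ≡ suc (toℕ e)
label-arcsFirst-arc G e =
  cong suc (trans (Finₚ.toℕ-cast _ _) (Finₚ.toℕ-↑ˡ e (nV G)))

label-arcsFirst-vertex : ∀ G x → label G (arcsFirst G) (inj₁ x) ≡ suc (nA G ℕ.+ toℕ x)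
label-arcsFirst-vertex G x =
  cong suc (trans (Finₚ.toℕ-cast _ _) (Finₚ.toℕ-↑ʳ (nA G) x))

arcsFirst-strong* : ∀ G → IsStrong* G (arcsFirst G)
arcsFirst-strong* G = arc-labels-bounded , arc-labels-onto
  where
  arc-labels-bounded : ∀ e → label G (arcsFirst G) (inj₂ e) ℕ.≤ nA G
  arc-labels-bounded e rewrite label-arcsFirst-arc G e = Finₚ.toℕ<n e
  arc-labels-onto : ∀ k → 1 ℕ.≤ k → k ℕ.≤ nA G → ∃[ e ] (label G (arcsFirst G) (inj₂ e) ≡ k)
  arc-labels-onto (suc k) _ k<nA =
    fromℕ< k<nA , trans (label-arcsFirst-arc G _) (cong suc (Finₚ.toℕ-fromℕ< k<nA))

-- σ i is the vertex of weight a + i·d; surjectivity of σ suffices, as distinct ranks have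
-- distinct weights.
svadal-of-ranking : (G : Digraph) (λ' : TotalLabeling G) (a d : ℤ) .{{_ : NonZero d}}
  (σ : Fin (nV G) → Fin (nV G)) → (∀ x → ∃[ i ] σ i ≡ x) →
  (∀ i → wt⁻ G λ' (σ i) ≡ a ℤ.+ + toℕ i ℤ.* d) → IsSVadAL G a d λ'
svadal-of-ranking G λ' a d σ σ-onto wt-σ = distinct , in-range , attained
  where
  rank-injective : ∀ {i j} → wt⁻ G λ' (σ i) ≡ wt⁻ G λ' (σ j) → i ≡ j
  rank-injective {i} {j} eq = Finₚ.toℕ-injective (ℤₚ.+-injective
    (ℤₚ.*-cancelʳ-≡ _ _ d (∙-cancelˡ a _ _ (trans (sym (wt-σ i)) (trans eq (wt-σ j))))))

  distinct : IsSVAL G λ'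
  distinct x y eq with σ-onto x | σ-onto y
  ... | i , refl | j , refl = cong σ (rank-injective eq)

  in-range : ∀ x → ∃[ i ] (i < nV G × wt⁻ G λ' x ≡ a ℤ.+ + i ℤ.* d)
  in-range x with σ-onto x
  ... | i , refl = toℕ i , Finₚ.toℕ<n i , wt-σ i

  attained : ∀ i → i < nV G → ∃[ x ] (wt⁻ G λ' x ≡ a ℤ.+ + i ℤ.* d)
  attained i i<nV = σ (fromℕ< i<nV) ,
    trans (wt-σ _) (cong (λ k → a ℤ.+ + k ℤ.* d) (Finₚ.toℕ-fromℕ< i<nV))

towardsZero : (n : ℕ) → Orientation n
towardsZero _ _ = false

inPath : ℕ → Digraph
inPath m = dipath (suc m) (towardsZero (suc m))

inflow outflow : (G : Digraph) → TotalLabeling G → Fin (nV G) → ℤ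
inflow  G λ' x = sumWhere (nA G) (λ a → does (head G a Fin.≟ x)) (λ a → + label G λ' (inj₂ a))
outflow G λ' x = sumWhere (nA G) (λ a → does (tail G a Fin.≟ x)) (λ a → + label G λ' (inj₂ a))

wt⁻-from-flows : ∀ G λ' x {l i o r} → label G λ' (inj₁ x) ≡ l →
  inflow G λ' x ≡ + i → outflow G λ' x ≡ + o → l ℕ.+ i ≡ r ℕ.+ o → wt⁻ G λ' x ≡ + r
wt⁻-from-flows G λ' x {i = i} {o} {r} label≡l inflow≡i outflow≡o l+i≡r+o = begin
  (+ lₓ ℤ.+ inflow G λ' x) ℤ.- outflow G λ' x
    ≡⟨ cong₂ (λ p q → (+ lₓ ℤ.+ p) ℤ.- q) inflow≡i outflow≡o ⟩
  (+ lₓ ℤ.+ + i) ℤ.- + o  ≡⟨ cong (λ k → k ℤ.- + o) (sym (ℤₚ.pos-+ lₓ i)) ⟩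
  + (lₓ ℕ.+ i) ℤ.- + o    ≡⟨ cong (λ k → + k ℤ.- + o) (trans (cong (ℕ._+ i) label≡l) l+i≡r+o) ⟩
  + (r ℕ.+ o) ℤ.- + o     ≡⟨ cong (λ k → k ℤ.- + o) (ℤₚ.pos-+ r o) ⟩
  (+ r ℤ.+ + o) ℤ.- + o   ≡⟨ //-rightDividesʳ (+ o) (+ r) ⟩
  + r                     ∎
  where
  open ≡-Reasoning
  lₓ : ℕ
  lₓ = label G λ' (inj₁ x)

vertexOfRank : ∀ m → Fin (suc m) → Fin (suc m)
vertexOfRank m fzero    = fromℕ m
vertexOfRank m (fsuc y) = inject₁ y

vertexOfRank-onto : ∀ m x → ∃[ i ] vertexOfRank m i ≡ x
vertexOfRank-onto zero    fzero    = fzero , refl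
vertexOfRank-onto (suc m) fzero    = fsuc fzero , refl
vertexOfRank-onto (suc m) (fsuc x) with vertexOfRank-onto m x
... | fzero  , refl = fzero , refl
... | fsuc y , refl = fsuc (fsuc y) , refl

module _ (m : ℕ) where
  private
    G : Digraph
    G = inPath m
    λ' : TotalLabeling G
    λ' = arcsFirst G

  inflow-last : inflow G λ' (fromℕ m) ≡ + 0
  inflow-last = sumWhere-≟-∉ m inject₁ (fromℕ m) (λ i → Finₚ.fromℕ≢inject₁ ∘ sym) _

  inflow-inject₁ : ∀ y → inflow G λ' (inject₁ y) ≡ + suc (toℕ y)
  inflow-inject₁ y = trans (sumWhere-≟-injective m Finₚ.inject₁-injective y _)
                           (cong +_ (label-arcsFirst-arc G y))

  outflow-toℕ : ∀ x → outflow G λ' x ≡ + toℕ x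
  outflow-toℕ fzero    = sumWhere-≟-∉ m fsuc fzero (λ i ()) (λ a → + label G λ' (inj₂ a))
  outflow-toℕ (fsuc y) = trans (sumWhere-≟-injective m Finₚ.suc-injective y _)
                               (cong +_ (label-arcsFirst-arc G y))

  wt⁻-vertexOfRank : ∀ i → wt⁻ G λ' (vertexOfRank m i) ≡ + (suc m ℕ.+ toℕ i)
  wt⁻-vertexOfRank fzero = wt⁻-from-flows G λ' (fromℕ m)
    (trans (label-arcsFirst-vertex G _) (cong (λ t → suc (m ℕ.+ t)) (Finₚ.toℕ-fromℕ m)))
    inflow-last
    (trans (outflow-toℕ _) (cong +_ (Finₚ.toℕ-fromℕ m)))
    (last-balance m)
    where
    last-balance : ∀ m → suc (m ℕ.+ m) ℕ.+ 0 ≡ suc m ℕ.+ 0 ℕ.+ m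
    last-balance = solve-∀
  wt⁻-vertexOfRank (fsuc y) = wt⁻-from-flows G λ' (inject₁ y)
    (trans (label-arcsFirst-vertex G _) (cong (λ t → suc (m ℕ.+ t)) (Finₚ.toℕ-inject₁ y)))
    (inflow-inject₁ y)
    (trans (outflow-toℕ _) (cong +_ (Finₚ.toℕ-inject₁ y)))
    (inner-balance m (toℕ y))
    where
    inner-balance : ∀ m t → suc (m ℕ.+ t) ℕ.+ suc t ≡ suc m ℕ.+ suc t ℕ.+ t
    inner-balance = solve-∀

mainTheorem4 : (n : ℕ) → 1 < n →
    ∃[ o ] ∃[ λ' ] (IsStrong* (dipath n o) λ' × IsSVadAL (dipath n o) (+ n) (+ 1) λ')
mainTheorem4 (suc m) _ =
  towardsZero (suc m) , arcsFirst (inPath m) , arcsFirst-strong* (inPath m) ,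
  svadal-of-ranking (inPath m) (arcsFirst (inPath m)) (+ suc m) (+ 1)
    (vertexOfRank m) (vertexOfRank-onto m)
    (λ i → trans (wt⁻-vertexOfRank m i) (scale (toℕ i)))
  where
  scale : ∀ k → + (suc m ℕ.+ k) ≡ + suc m ℤ.+ + k ℤ.* + 1
  scale k = trans (ℤₚ.pos-+ (suc m) k) (cong (λ z → + suc m ℤ.+ z) (sym (ℤₚ.*-identityʳ (+ k))))
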